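{- Every dextro-nut digraph, every laevo-nut digraph and every inter-nut digraph is connected.
   Context: A digraph $G$ is a finite nonempty vertex set $V(G)$ with an arbitrary binary relation $\to$. Write $G^+(v)=\{u: v\to u\}$, $G^-(v)=\{u:u\to v\}$. $\operatorname{Ker}G=\{\mathbf{x}\colon V(G)\to\mathbb{R} : \sum_{u\in G^+(v)}\mathbf{x}(u)=0\ \forall v\}$ and $\operatorname{CoKer}G=\{\mathbf{x} : \sum_{u\in G^-(v)}\mathbf{x}(u)=0\ \forall v\}$. A vector is full if it has no zero entry. $G$ is dextro-nut (resp. laevo-nut) if $\operatorname{Ker}G$ (resp. $\operatorname{CoKer}G$) is one-dimensional and spanned by a full vector; inter-nut if $\operatorname{Ker}G\cap\operatorname{CoKer}G$ is one-dimensional and spanned by a full vector. The underlying graph of $G$ is the simple graph on $V(G)$ in which distinct $u,v$ are adjacent iff $u\to v$ or $v\to u$; $G$ is connected if its underlying graph is connected.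
   Formalization: The vectors of Ker G and CoKer G, and the scalars spanning them, are rational instead of real in the definitions of dextro-nut, laevo-nut and inter-nut. -}

module Defs where

open import Data.Nat using (ℕ; zero; suc)
open import Data.Fin using (Fin; zero; suc)
open import Data.Bool using (Bool; true; false; if_then_else_)
open import Data.Rational using (ℚ; 0ℚ; _+_; _*_)
open import Data.Product using (Σ; ∃; _×_)
open import Data.Sum using (_⊎_)
open import Relation.Binary.PropositionalEquality using (_≡_; _≢_)
open import Relation.Nullary using (¬_)

Digraph : ℕ → Set
Digraph n = Fin n → Fin n → Bool

sumFin : (n : ℕ) → (Fin n → ℚ) → ℚ
sumFin zero    f = 0ℚ
sumFin (suc n) f = f zero + sumFin n (λ i → f (suc i))

Vector : ℕ → Set
Vector n = Fin n → ℚ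

InKer : {n : ℕ} → Digraph n → Vector n → Set
InKer {n} G x = ∀ v → sumFin n (λ u → if G v u then x u else 0ℚ) ≡ 0ℚ

InCoKer : {n : ℕ} → Digraph n → Vector n → Set
InCoKer {n} G x = ∀ v → sumFin n (λ u → if G u v then x u else 0ℚ) ≡ 0ℚ

Full : {n : ℕ} → Vector n → Set
Full x = ∀ v → x v ≢ 0ℚ

OneDimFullSpan : {n : ℕ} → (Vector n → Set) → Set
OneDimFullSpan {n} P =
  Σ (Vector n) λ x → P x × Full x × (∀ y → P y → ∃ λ (c : ℚ) → ∀ v → y v ≡ c * x v)

DextroNut : {n : ℕ} → Digraph n → Set
DextroNut G = OneDimFullSpan (InKer G)

LaevoNut : {n : ℕ} → Digraph n → Set
LaevoNut G = OneDimFullSpan (InCoKer G)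

InterNut : {n : ℕ} → Digraph n → Set
InterNut G = OneDimFullSpan (λ x → InKer G x × InCoKer G x)

-- Adjacency in the underlying simple graph: distinct u, v with u → v or v → u.
Adjacent : {n : ℕ} → Digraph n → Fin n → Fin n → Set
Adjacent G u v = u ≢ v × (G u v ≡ true ⊎ G v u ≡ true)

data Reachable {n : ℕ} (G : Digraph n) : Fin n → Fin n → Set where
  here : ∀ {u} → Reachable G u u
  step : ∀ {u w v} → Adjacent G u w → Reachable G w v → Reachable G u v

Connected : {n : ℕ} → Digraph n → Set
Connected G = ∀ u v → Reachable G u v

{-# OPTIONS --safe #-}
-- Let S be the connected component of a vertex u. No arc joins S to its
-- complement, so restricting a vector to S preserves membership of Ker and of
-- CoKer. If that space is spanned by a full vector x, the restriction of x to S
-- equals c x for some c; at a vertex outside S this forces c = 0, and then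
-- x u = 0, contradicting fullness. So S contains every vertex. Membership of S
-- must be decidable, so S is computed by saturating {u} along arcs, by
-- well-founded recursion on strict supersets.
module Submission where

open import Defs
open import Data.Nat using (ℕ; zero; suc)
open import Data.Bool using (true; false; if_then_else_)
open import Data.Bool.Properties using (_≟_)
open import Data.Fin using (Fin; zero; suc)
open import Data.Fin.Properties using (any?)
open import Data.Fin.Subset using (Subset; _∈_; _∉_; _∪_; ⁅_⁆; _⊂_; _⊃_)
open import Data.Fin.Subset.Properties using (_∈?_; p⊆p∪q; q⊆p∪q; x∈p∪q⁻; x∈⁅x⁆; x∈⁅y⁆⇒x≡y)
open import Data.Fin.Subset.Induction using (⊃-wellFounded)
open import Data.Rational using (ℚ; 0ℚ; 1ℚ; _+_; _*_; 1/_; ≢-nonZero)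
open import Data.Rational.Properties using (+-identityˡ; *-zeroˡ; *-identityʳ; *-inverseʳ; *-assoc)
open import Data.Product using (_,_)
open import Data.Sum using (_⊎_; inj₁; inj₂; swap)
open import Function using (_∘_)
open import Induction.WellFounded using (Acc; acc)
open import Relation.Binary.Definitions using (Decidable)
open import Relation.Nullary using (yes; no; ¬?; contradiction)
open import Relation.Nullary.Decidable using (_×-dec_; _⊎-dec_)
open import Relation.Binary.PropositionalEquality
  using (_≡_; _≢_; _≗_; refl; sym; trans; cong; cong₂; module ≡-Reasoning)

private
  variable
    n : ℕ
    u v w : Fin n
    S : Subset n
    x : Vector n

p*q≡0⇒p≡0 : ∀ {p q : ℚ} → q ≢ 0ℚ → p * q ≡ 0ℚ → p ≡ 0ℚ
p*q≡0⇒p≡0 {p} {q} q≢0 pq≡0 = begin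
  p                ≡⟨ sym (*-identityʳ p) ⟩
  p * 1ℚ           ≡⟨ cong (p *_) (sym (*-inverseʳ q)) ⟩
  p * (q * 1/ q)   ≡⟨ sym (*-assoc p q (1/ q)) ⟩
  (p * q) * 1/ q   ≡⟨ cong (_* 1/ q) pq≡0 ⟩
  0ℚ * 1/ q        ≡⟨ *-zeroˡ (1/ q) ⟩
  0ℚ               ∎
  where
  open ≡-Reasoning
  instance _ = ≢-nonZero q≢0

sumFin-cong : ∀ n {f g : Fin n → ℚ} → f ≗ g → sumFin n f ≡ sumFin n g
sumFin-cong zero    f≗g = refl
sumFin-cong (suc n) f≗g = cong₂ _+_ (f≗g zero) (sumFin-cong n (f≗g ∘ suc))

sumFin-zero : ∀ n → sumFin n (λ _ → 0ℚ) ≡ 0ℚ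
sumFin-zero zero    = refl
sumFin-zero (suc n) = trans (cong (0ℚ +_) (sumFin-zero n)) (+-identityˡ 0ℚ)

restrict : Subset n → Vector n → Vector n
restrict S x v with v ∈? S
... | yes _ = x v
... | no  _ = 0ℚ

restrict-∈ : v ∈ S → restrict S x v ≡ x v
restrict-∈ {v = v} {S = S} v∈S with v ∈? S
... | yes _   = refl
... | no  v∉S = contradiction v∈S v∉S

restrict-∉ : v ∉ S → restrict S x v ≡ 0ℚ
restrict-∉ {v = v} {S = S} v∉S with v ∈? S
... | yes v∈S = contradiction v∈S v∉S
... | no  _   = refl

RestrictionClosed : Subset n → (Vector n → Set) → Set
RestrictionClosed S P = ∀ {x} → P x → P (restrict S x)

full-span-restrictionClosed : {P : Vector n → Set} → OneDimFullSpan P →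
                              RestrictionClosed S P → u ∈ S → v ∈ S
full-span-restrictionClosed {S = S} {u = u} {v = v} (x , Px , full , spans) closed u∈S
  with v ∈? S | spans (restrict S x) (closed Px)
... | yes v∈S | _          = v∈S
... | no  v∉S | c , y≡c*x  = contradiction xu≡0 (full u)
  where
  open ≡-Reasoning
  c≡0 : c ≡ 0ℚ
  c≡0 = p*q≡0⇒p≡0 (full v) (trans (sym (y≡c*x v)) (restrict-∉ v∉S))
  xu≡0 : x u ≡ 0ℚ
  xu≡0 = begin
    x u             ≡⟨ sym (restrict-∈ u∈S) ⟩
    restrict S x u  ≡⟨ y≡c*x u ⟩
    c * x u         ≡⟨ cong (_* x u) c≡0 ⟩
    0ℚ * x u        ≡⟨ *-zeroˡ (x u) ⟩
    0ℚ              ∎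

transpose : Digraph n → Digraph n
transpose G v w = G w v

Linked : Digraph n → Fin n → Fin n → Set
Linked G v w = G v w ≡ true ⊎ G w v ≡ true

linked? : (G : Digraph n) → Decidable (Linked G)
linked? G v w = (G v w ≟ true) ⊎-dec (G w v ≟ true)

Closed : Digraph n → Subset n → Set
Closed G S = ∀ {v w} → Linked G v w → v ∈ S → w ∈ S

Closed-transpose : {G : Digraph n} → Closed G S → Closed (transpose G) S
Closed-transpose closed = closed ∘ swap

InKer-restrictionClosed : (G : Digraph n) → Closed G S → RestrictionClosed S (InKer G)
InKer-restrictionClosed {n} {S} G closed {x} x∈Ker v with v ∈? S
... | yes v∈S = trans (sumFin-cong n unchanged) (x∈Ker v)
  where
  unchanged : ∀ w → (if G v w then restrict S x w else 0ℚ) ≡ (if G v w then x w else 0ℚ)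
  unchanged w with G v w in vw
  ... | true  = restrict-∈ (closed (inj₁ vw) v∈S)
  ... | false = refl
... | no v∉S = trans (sumFin-cong n vanishing) (sumFin-zero n)
  where
  vanishing : ∀ w → (if G v w then restrict S x w else 0ℚ) ≡ 0ℚ
  vanishing w with G v w in vw
  ... | true  = restrict-∉ (v∉S ∘ closed (inj₂ vw))
  ... | false = refl

snoc : {G : Digraph n} → Reachable G u v → Adjacent G v w → Reachable G u w
snoc here       vw = step vw here
snoc (step a r) vw = step a (snoc r vw)

record Component (G : Digraph n) (u : Fin n) : Set where
  field
    members   : Subset n
    root      : u ∈ members
    reachable : ∀ {v} → v ∈ members → Reachable G u v
    closed    : Closed G members

module _ (G : Digraph n) (u : Fin n) where

  private
    saturate : (S : Subset n) → Acc _⊃_ S → u ∈ S →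
               (∀ {v} → v ∈ S → Reachable G u v) → Component G u
    saturate S (acc larger) u∈S reach
      with any? (λ v → any? (λ w → v ∈? S ×-dec ¬? (w ∈? S) ×-dec linked? G v w))
    ... | no none = record { members = S ; root = u∈S ; reachable = reach ; closed = closed }
      where
      closed : Closed G S
      closed {v} {w} vw v∈S with w ∈? S
      ... | yes w∈S = w∈S
      ... | no  w∉S = contradiction (v , w , v∈S , w∉S , vw) none
    ... | yes (v , w , v∈S , w∉S , vw) =
      saturate (S ∪ ⁅ w ⁆) (larger S⊂S∪w) (p⊆p∪q ⁅ w ⁆ u∈S) reach′
      where
      S⊂S∪w : S ⊂ S ∪ ⁅ w ⁆
      S⊂S∪w = p⊆p∪q ⁅ w ⁆ , w , q⊆p∪q S ⁅ w ⁆ (x∈⁅x⁆ w) , w∉S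
      reach′ : ∀ {z} → z ∈ S ∪ ⁅ w ⁆ → Reachable G u z
      reach′ z∈S∪w with x∈p∪q⁻ S ⁅ w ⁆ z∈S∪w
      ... | inj₁ z∈S = reach z∈S
      ... | inj₂ z∈w with x∈⁅y⁆⇒x≡y w z∈w
      ...   | refl = snoc (reach v∈S) ((λ { refl → w∉S v∈S }) , vw)

  component : Component G u
  component = saturate ⁅ u ⁆ (⊃-wellFounded ⁅ u ⁆) (x∈⁅x⁆ u) reach
    where
    reach : ∀ {v} → v ∈ ⁅ u ⁆ → Reachable G u v
    reach v∈u with x∈⁅y⁆⇒x≡y u v∈u
    ... | refl = here

lemma13 : (m : ℕ) (G : Digraph (suc m)) →
          DextroNut G ⊎ LaevoNut G ⊎ InterNut G → Connected G
lemma13 m G nut u v = reachable (v∈members nut)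
  where
  open Component (component G u)
  ker : RestrictionClosed members (InKer G)
  ker = InKer-restrictionClosed G closed
  coker : RestrictionClosed members (InCoKer G)
  coker = InKer-restrictionClosed (transpose G) (Closed-transpose closed)
  v∈members : DextroNut G ⊎ LaevoNut G ⊎ InterNut G → v ∈ members
  v∈members (inj₁ dextro)         = full-span-restrictionClosed dextro ker root
  v∈members (inj₂ (inj₁ laevo))   = full-span-restrictionClosed laevo coker root
  v∈members (inj₂ (inj₂ inter))   =
    full-span-restrictionClosed inter (λ (k , c) → ker k , coker c) root
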